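{- Let $m$ and $k$ be positive integers. Then $\mathrm{Pyr}^k(\mathcal{T}_m)$ is a $(k+3)$-dimensional integral polytope, and its Ehrhart polynomial satisfies $$i(\mathrm{Pyr}^k(\mathcal{T}_m),t)=\binom{t+k+3}{k+3}+(m-1)\binom{t+k+1}{k+3}\quad\text{for all integers } t\ge1.$$
   Context: An integral polytope is a convex polytope all of whose vertices have integer coordinates; for such $\mathcal{P}\subseteq\mathbb{R}^N$, $i(\mathcal{P},t)=|t\mathcal{P}\cap\mathbb{Z}^N|$ for positive integers $t$ (the Ehrhart polynomial). For a positive integer $m$, the Reeve tetrahedron $\mathcal{T}_m\subseteq\mathbb{R}^3$ is the convex hull of $(0,0,0),(1,0,0),(0,1,0),(1,1,m)$. For a polytope $\mathcal{P}\subseteq\mathbb{R}^N$ with vertices $v_1,\dots,v_s$, its pyramid is $\mathrm{Pyr}(\mathcal{P})=\mathrm{conv}\{(v_1,0),\dots,(v_s,0),(0,\dots,0,1)\}\subseteq\mathbb{R}^{N+1}$; $\mathrm{Pyr}^1=\mathrm{Pyr}$ and $\mathrm{Pyr}^k(\mathcal{P})=\mathrm{Pyr}(\mathrm{Pyr}^{k-1}(\mathcal{P}))$ for $k\ge2$. -}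

module Defs where

open import Data.Nat as ℕ using (ℕ; zero; suc)
open import Data.Integer as ℤ using (ℤ; +_)
open import Data.Rational as ℚ using (ℚ; 0ℚ; 1ℚ; _/_)
open import Data.Fin using (Fin; zero; suc)
open import Data.Vec using (Vec; []; _∷_; lookup; map; replicate; _∷ʳ_)
open import Data.Product using (Σ; _×_; ∃)
open import Data.List using (List)
open import Relation.Binary.PropositionalEquality using (_≡_)
open import Relation.Nullary using (¬_)

∑ : ∀ {n} → (Fin n → ℚ) → ℚ
∑ {zero} f = 0ℚ
∑ {suc n} f = f zero ℚ.+ ∑ (λ i → f (suc i))

toℚ : ℤ → ℚ
toℚ z = z / 1

toℚᵛ : ∀ {N} → Vec ℤ N → Vec ℚ N
toℚᵛ = map toℚ

InConv : ∀ {N s} → Vec (Vec ℤ N) s → Vec ℚ N → Set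
InConv {N} {s} vs x =
  Σ (Fin s → ℚ) λ c →
    (∀ i → 0ℚ ℚ.≤ c i) ×
    (∑ c ≡ 1ℚ) ×
    (∀ (j : Fin N) → lookup x j ≡ ∑ (λ i → c i ℚ.* toℚ (lookup (lookup vs i) j)))

InDilate : ∀ {N} → ℕ → (Vec ℚ N → Set) → Vec ℚ N → Set
InDilate {N} t P x = Σ (Vec ℚ N) λ y → P y × (x ≡ map (λ q → (+ t / 1) ℚ.* q) y)

AffInd : ∀ {N r} → Vec (Vec ℚ N) r → Set
AffInd {N} {r} ps =
  (c : Fin r → ℚ) →
  ∑ c ≡ 0ℚ →
  (∀ (j : Fin N) → ∑ (λ i → c i ℚ.* lookup (lookup ps i) j) ≡ 0ℚ) →
  ∀ i → c i ≡ 0ℚ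

AllIn : ∀ {N r} → (Vec ℚ N → Set) → Vec (Vec ℚ N) r → Set
AllIn {r = r} P ps = ∀ (i : Fin r) → P (lookup ps i)

-- dim P = d : the affine hull of P has dimension d, i.e. P contains d+1
-- affinely independent points but not d+2.
HasDim : ∀ {N} → (Vec ℚ N → Set) → ℕ → Set
HasDim {N} P d =
  (Σ (Vec (Vec ℚ N) (suc d)) λ ps → AllIn P ps × AffInd ps) ×
  ((ps : Vec (Vec ℚ N) (suc (suc d))) → AllIn P ps → ¬ AffInd ps)

reeve : ℕ → Vec (Vec ℤ 3) 4
reeve m = (+ 0 ∷ + 0 ∷ + 0 ∷ []) ∷ (+ 1 ∷ + 0 ∷ + 0 ∷ []) ∷
          (+ 0 ∷ + 1 ∷ + 0 ∷ []) ∷ (+ 1 ∷ + 1 ∷ + m ∷ []) ∷ []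

pyr : ∀ {N s} → Vec (Vec ℤ N) s → Vec (Vec ℤ (suc N)) (suc s)
pyr {N} vs = map (λ v → v ∷ʳ + 0) vs ∷ʳ (replicate N (+ 0) ∷ʳ + 1)

pyrReeve : (k m : ℕ) → Vec (Vec ℤ (k ℕ.+ 3)) (k ℕ.+ 4)
pyrReeve zero m = reeve m
pyrReeve (suc k) m = pyr (pyrReeve k m)

PyrReeve : (k m : ℕ) → Vec ℚ (k ℕ.+ 3) → Set
PyrReeve k m = InConv (pyrReeve k m)

{-# OPTIONS --safe #-}
module Submission where

-- By its facet inequalities, (x, y, z) lies in t·T_m iff 0 ≤ z ≤ m·x, z ≤ m·y and m·(x + y) ≤ m·t + z.
-- Writing z = q·m + r with 0 ≤ r < m, the integer points with r = 0 are the (q + a, q + b, q·m) with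
-- (q, a, b) a lattice point of t·Δ₃ (Δ₃ the standard simplex), and those with r ≠ 0 are the
-- (q + a + 1, q + b + 1, q·m + r) with (q, a, b) in (t − 2)·Δ₃.  As t·Δ_d has C(t + d, d) lattice points,
-- i(T_m, t) = C(t + 3, 3) + (m − 1)·C(t + 1, 3).  The lattice points of t·Pyr(P) with last coordinate h
-- are those of (t − h)·P, so i(Pyr P, t) = Σ_{u ≤ t} i(P, u), and the hockey-stick identity
-- Σ_{u ≤ t} C(u + s, q) = C(t + 1 + s, q + 1) (s ≤ q) takes the formula from k to k + 1.  For the
-- dimension, the k + 4 vertices of Pyr^k(T_m) are affinely independent, and by Gaussian elimination
-- no k + 5 points of ℚ^(k+3) are.

open import Defs
open import Data.Nat as ℕ using (ℕ; zero; suc; s≤s; z≤n)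
import Data.Nat.Properties as ℕP
open import Data.Integer as ℤ using (ℤ; +_; -[1+_])
import Data.Integer.Properties as ℤP
open import Data.Fin as Fin using (Fin; zero; suc; inject₁; fromℕ; punchIn; punchOut)
import Data.Fin.Properties as FinP
open import Data.Fin.Patterns using (0F; 1F; 2F; 3F)
open import Data.Vec as Vec using (Vec; []; _∷ʳ_; lookup)
import Data.Vec.Properties as VecP
open import Data.Vec.Functional using (_∷_; init; last)
open import Data.List as List using (List; map; concatMap; downFrom; length; _++_)
open import Data.List.Properties using (length-++; length-map)
open import Data.List.Membership.Propositional using (_∈_; find)
open import Data.List.Membership.Propositional.Properties
  using (∈-concatMap⁺; ∈-concatMap⁻; ∈-downFrom⁺; ∈-downFrom⁻; ∈-map⁺; ∈-map⁻; ∈-++⁺ˡ; ∈-++⁺ʳ; ∈-++⁻)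
open import Data.List.Relation.Unary.All using (All)
import Data.List.Relation.Unary.All as All
import Data.List.Relation.Unary.AllPairs as AllPairs
import Data.List.Relation.Unary.Any as Any
open import Data.List.Relation.Unary.Unique.Propositional using (Unique)
import Data.List.Relation.Unary.Unique.Propositional.Properties as Unique
open import Data.Product using (Σ; ∃; ∃₂; _×_; _,_; proj₁; proj₂)
open import Data.Sum using (inj₁; inj₂)
open import Function using (_∘_; id; case_of_)
open import Relation.Binary.PropositionalEquality
open import Relation.Nullary using (¬_; yes; no)

module Geometry where

  open import Data.Rational as ℚ using (ℚ; 0ℚ; 1ℚ; mkℚ; _+_; _*_; -_; _-_; _≤_)
  import Data.Rational.Properties as ℚP
  import Data.Rational.Unnormalised as ℚᵘ
  import Data.Rational.Unnormalised.Properties as ℚᵘP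
  open import Data.Rational.Solver renaming (module +-*-Solver to ℚSolver)
  open import Data.Integer.Solver renaming (module +-*-Solver to ℤSolver)
  open import Data.Nat.Divisibility using (∣1⇒≡1)
  open import Algebra.Bundles using (Ring)
  open import Algebra.Properties.Group ℚP.+-0-group using (x∙y⁻¹≈ε⇒x≈y)
  import Algebra.Properties.Semiring.Sum

  toℚ≡mkℚ : ∀ z → toℚ z ≡ mkℚ z 0 (λ (_ , d∣1) → ∣1⇒≡1 d∣1)
  toℚ≡mkℚ z = ℚP.↥p/↧p≡p _

  toℚᵘ∘toℚ : ∀ z → ℚ.toℚᵘ (toℚ z) ℚᵘ.≃ ℚᵘ.mkℚᵘ z 0
  toℚᵘ∘toℚ z = ℚᵘP.≃-reflexive (cong ℚ.toℚᵘ (toℚ≡mkℚ z))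

  toℚ-+ : ∀ a b → toℚ (a ℤ.+ b) ≡ toℚ a + toℚ b
  toℚ-+ a b = ℚP.toℚᵘ-injective (begin
    ℚ.toℚᵘ (toℚ (a ℤ.+ b))                      ≈⟨ toℚᵘ∘toℚ (a ℤ.+ b) ⟩
    ℚᵘ.mkℚᵘ (a ℤ.+ b) 0                          ≈⟨ ℚᵘ.*≡* (solve 2 (λ a b → (a :+ b) :* one := (a :* one :+ b :* one) :* one) refl a b) ⟩
    ℚᵘ.mkℚᵘ a 0 ℚᵘ.+ ℚᵘ.mkℚᵘ b 0                 ≈⟨ ℚᵘP.+-cong (toℚᵘ∘toℚ a) (toℚᵘ∘toℚ b) ⟨
    ℚ.toℚᵘ (toℚ a) ℚᵘ.+ ℚ.toℚᵘ (toℚ b)           ≈⟨ ℚP.toℚᵘ-homo-+ (toℚ a) (toℚ b) ⟨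
    ℚ.toℚᵘ (toℚ a + toℚ b)                       ∎)
    where
    open ℚᵘP.≃-Reasoning
    open ℤSolver
    one : ∀ {n} → Polynomial n
    one = con (+ 1)

  toℚ-* : ∀ a b → toℚ (a ℤ.* b) ≡ toℚ a * toℚ b
  toℚ-* a b = ℚP.toℚᵘ-injective (begin
    ℚ.toℚᵘ (toℚ (a ℤ.* b))                      ≈⟨ toℚᵘ∘toℚ (a ℤ.* b) ⟩
    ℚᵘ.mkℚᵘ (a ℤ.* b) 0                          ≈⟨ ℚᵘ.*≡* refl ⟩
    ℚᵘ.mkℚᵘ a 0 ℚᵘ.* ℚᵘ.mkℚᵘ b 0                 ≈⟨ ℚᵘP.*-cong (toℚᵘ∘toℚ a) (toℚᵘ∘toℚ b) ⟨
    ℚ.toℚᵘ (toℚ a) ℚᵘ.* ℚ.toℚᵘ (toℚ b)           ≈⟨ ℚP.toℚᵘ-homo-* (toℚ a) (toℚ b) ⟨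
    ℚ.toℚᵘ (toℚ a * toℚ b)                       ∎)
    where open ℚᵘP.≃-Reasoning

  toℚ-mono-≤ : ∀ {a b} → a ℤ.≤ b → toℚ a ≤ toℚ b
  toℚ-mono-≤ {a} {b} a≤b rewrite toℚ≡mkℚ a | toℚ≡mkℚ b =
    ℚ.*≤* (subst₂ ℤ._≤_ (sym (ℤP.*-identityʳ a)) (sym (ℤP.*-identityʳ b)) a≤b)

  toℚ-cancel-≤ : ∀ {a b} → toℚ a ≤ toℚ b → a ℤ.≤ b
  toℚ-cancel-≤ {a} {b} toℚa≤toℚb rewrite toℚ≡mkℚ a | toℚ≡mkℚ b with toℚa≤toℚb
  ... | ℚ.*≤* a≤b = subst₂ ℤ._≤_ (ℤP.*-identityʳ a) (ℤP.*-identityʳ b) a≤b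

  toℚ-nonneg⇒ℕ : ∀ z → 0ℚ ≤ toℚ z → ∃ λ n → z ≡ + n
  toℚ-nonneg⇒ℕ (+ n)    _   = n , refl
  toℚ-nonneg⇒ℕ -[1+ n ] 0≤z with toℚ-cancel-≤ {+ 0} { -[1+ n ]} 0≤z
  ... | ()

  ι : ℕ → ℚ
  ι n = toℚ (+ n)

  ι-+ : ∀ m n → ι (m ℕ.+ n) ≡ ι m + ι n
  ι-+ m n = toℚ-+ (+ m) (+ n)

  ι-* : ∀ m n → ι (m ℕ.* n) ≡ ι m * ι n
  ι-* m n = trans (cong toℚ (ℤP.pos-* m n)) (toℚ-* (+ m) (+ n))

  ι-mono-≤ : ∀ {m n} → m ℕ.≤ n → ι m ≤ ι n
  ι-mono-≤ m≤n = toℚ-mono-≤ (ℤ.+≤+ m≤n)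

  ι-cancel-≤ : ∀ {m n} → ι m ≤ ι n → m ℕ.≤ n
  ι-cancel-≤ {m} {n} ιm≤ιn = ℤP.drop‿+≤+ (toℚ-cancel-≤ {+ m} {+ n} ιm≤ιn)

  0≤ι : ∀ n → 0ℚ ≤ ι n
  0≤ι n = ι-mono-≤ {0} {n} z≤n

  ι-suc-positive : ∀ n → ℚ.Positive (ι (suc n))
  ι-suc-positive n = subst ℚ.Positive (sym (toℚ≡mkℚ (+ suc n))) _

  ι-suc-nonZero : ∀ n → ℚ.NonZero (ι (suc n))
  ι-suc-nonZero n = ℚP.pos⇒nonZero (ι (suc n)) {{ι-suc-positive n}}

  1/ι-suc-nonneg : ∀ n → 0ℚ ≤ (ℚ.1/ ι (suc n)) {{ι-suc-nonZero n}}
  1/ι-suc-nonneg n = ℚP.nonNegative⁻¹ w {{ℚP.pos⇒nonNeg w {{ℚP.1/pos⇒pos (ι (suc n)) {{ι-suc-positive n}}}}}}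
    where
    w : ℚ
    w = (ℚ.1/ ι (suc n)) {{ι-suc-nonZero n}}

  0≤*-nonneg : ∀ {p q} → 0ℚ ≤ p → 0ℚ ≤ q → 0ℚ ≤ p * q
  0≤*-nonneg {p} {q} 0≤p 0≤q =
    ℚP.nonNegative⁻¹ _ {{ℚP.nonNeg*nonNeg⇒nonNeg p {{ℚ.nonNegative 0≤p}} q {{ℚ.nonNegative 0≤q}}}}

  p≤p+q : ∀ {p q} → 0ℚ ≤ q → p ≤ p + q
  p≤p+q {p} 0≤q = subst (_≤ p + _) (ℚP.+-identityʳ p) (ℚP.+-monoʳ-≤ p 0≤q)

  ≡+nonneg⇒≤ : ∀ {p q} d → 0ℚ ≤ d → q ≡ p + d → p ≤ q
  ≡+nonneg⇒≤ d 0≤d refl = p≤p+q 0≤d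

  p≤q⇒0≤q-p : ∀ {p q} → p ≤ q → 0ℚ ≤ q - p
  p≤q⇒0≤q-p {p} {q} p≤q = subst (_≤ q - p) (ℚP.+-inverseʳ p) (ℚP.+-monoˡ-≤ (- p) p≤q)

  0≤q-p⇒p≤q : ∀ {p q} → 0ℚ ≤ q - p → p ≤ q
  0≤q-p⇒p≤q {p} {q} 0≤q-p = ≡+nonneg⇒≤ (q - p) 0≤q-p (solve 2 (λ p q → q := p :+ (q :- p)) refl p q)
    where open ℚSolver

  0≤≤*⇒0≤ : ∀ r {p q} → ℚ.Positive r → 0ℚ ≤ p → p ≤ r * q → 0ℚ ≤ q
  0≤≤*⇒0≤ r {p} {q} r>0 0≤p p≤rq =
    ℚP.*-cancelˡ-≤-pos r {{r>0}} (subst (_≤ r * q) (sym (ℚP.*-zeroʳ r)) (ℚP.≤-trans 0≤p p≤rq))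

  -- Finite sums and linear algebra over ℚ

  module ℚSum = Algebra.Properties.Semiring.Sum (Ring.semiring ℚP.+-*-ring)

  ∑≡sum : ∀ {n} (f : Fin n → ℚ) → ∑ f ≡ ℚSum.sum f
  ∑≡sum {zero}  f = refl
  ∑≡sum {suc n} f = cong (_+_ (f zero)) (∑≡sum (f ∘ suc))

  ∑-cong : ∀ {n} {f g : Fin n → ℚ} → f ≗ g → ∑ f ≡ ∑ g
  ∑-cong {f = f} {g} f≗g = trans (∑≡sum f) (trans (ℚSum.sum-cong-≗ f≗g) (sym (∑≡sum g)))

  ∑-distrib-+ : ∀ {n} (f g : Fin n → ℚ) → ∑ (λ i → f i + g i) ≡ ∑ f + ∑ g
  ∑-distrib-+ f g = trans (∑≡sum (λ i → f i + g i)) (trans (ℚSum.∑-distrib-+ f g) (sym (cong₂ _+_ (∑≡sum f) (∑≡sum g))))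

  *-distribˡ-∑ : ∀ {n} a (f : Fin n → ℚ) → a * ∑ f ≡ ∑ (λ i → a * f i)
  *-distribˡ-∑ a f = trans (cong (a *_) (∑≡sum f)) (trans (ℚSum.*-distribˡ-sum a f) (sym (∑≡sum (λ i → a * f i))))

  ∑-init-last : ∀ {n} (f : Fin (suc n) → ℚ) → ∑ f ≡ ∑ (init f) + last f
  ∑-init-last f = trans (∑≡sum f) (trans (ℚSum.sum-init-last f) (cong (_+ last f) (sym (∑≡sum (init f)))))

  ∑-zero : ∀ n → ∑ {n} (λ _ → 0ℚ) ≡ 0ℚ
  ∑-zero n = trans (∑≡sum {n} (λ _ → 0ℚ)) (ℚSum.sum-replicate-zero n)

  ∑-nonneg : ∀ {n} {f : Fin n → ℚ} → (∀ i → 0ℚ ≤ f i) → 0ℚ ≤ ∑ f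
  ∑-nonneg {zero}  _   = ℚP.≤-refl
  ∑-nonneg {suc n} 0≤f = ℚP.+-mono-≤ (0≤f zero) (∑-nonneg (0≤f ∘ suc))

  infix 7 _·_
  _·_ : ∀ {n} → (Fin n → ℚ) → (Fin n → ℚ) → ℚ
  c · a = ∑ (λ i → c i * a i)

  ·-init-last : ∀ {n} (c a : Fin (suc n) → ℚ) → c · a ≡ init c · init a + last c * last a
  ·-init-last c a = ∑-init-last (λ i → c i * a i)

  ·-linearʳ : ∀ {n} (c u v : Fin n → ℚ) k → c · (λ i → u i - k * v i) ≡ c · u - k * (c · v)
  ·-linearʳ c u v k = begin
    c · (λ i → u i - k * v i)                      ≡⟨ ∑-cong (λ i → distrib (c i) (u i) (v i) k) ⟩
    ∑ (λ i → c i * u i + (- k) * (c i * v i))      ≡⟨ ∑-distrib-+ (λ i → c i * u i) (λ i → (- k) * (c i * v i)) ⟩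
    c · u + ∑ (λ i → (- k) * (c i * v i))          ≡⟨ cong (_+_ (c · u)) (*-distribˡ-∑ (- k) (λ i → c i * v i)) ⟨
    c · u + (- k) * (c · v)                        ≡⟨ solve 3 (λ x k y → x :+ (:- k) :* y := x :- k :* y) refl (c · u) k (c · v) ⟩
    c · u - k * (c · v)                            ∎
    where
    open ≡-Reasoning
    open ℚSolver
    distrib : ∀ c u v k → c * (u - k * v) ≡ c * u + (- k) * (c * v)
    distrib = solve 4 (λ c u v k → c :* (u :- k :* v) := c :* u :+ (:- k) :* (c :* v)) refl

  basis : ∀ {n} → Fin n → Fin n → ℚ
  basis zero    zero    = 1ℚ
  basis zero    (suc i) = 0ℚ
  basis (suc p) zero    = 0ℚ
  basis (suc p) (suc i) = basis p i

  basis-nonneg : ∀ {n} (p i : Fin n) → 0ℚ ≤ basis p i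
  basis-nonneg zero    zero    = ℚP.nonNegative⁻¹ 1ℚ
  basis-nonneg zero    (suc i) = ℚP.≤-refl
  basis-nonneg (suc p) zero    = ℚP.≤-refl
  basis-nonneg (suc p) (suc i) = basis-nonneg p i

  basis-· : ∀ {n} (p : Fin n) (f : Fin n → ℚ) → basis p · f ≡ f p
  basis-· {suc n} zero f = begin
    1ℚ * f zero + ∑ (λ i → 0ℚ * f (suc i))   ≡⟨ cong₂ _+_ (ℚP.*-identityˡ (f zero)) (∑-cong (ℚP.*-zeroˡ ∘ f ∘ suc)) ⟩
    f zero + ∑ {n} (λ _ → 0ℚ)               ≡⟨ cong (_+_ (f zero)) (∑-zero n) ⟩
    f zero + 0ℚ                             ≡⟨ ℚP.+-identityʳ (f zero) ⟩
    f zero                                  ∎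
    where open ≡-Reasoning
  basis-· {suc n} (suc p) f = trans (cong₂ _+_ (ℚP.*-zeroˡ (f zero)) (basis-· p (f ∘ suc))) (ℚP.+-identityˡ (f (suc p)))

  ∑-basis : ∀ {n} (p : Fin n) → ∑ (basis p) ≡ 1ℚ
  ∑-basis p = trans (∑-cong (λ i → sym (ℚP.*-identityʳ (basis p i)))) (basis-· p (λ _ → 1ℚ))

  NontrivialKernelVector : ∀ {M n} → (Fin M → Fin n → ℚ) → (Fin n → ℚ) → Set
  NontrivialKernelVector A c = (∀ r → c · A r ≡ 0ℚ) × ∃ λ i → c i ≢ 0ℚ

  -- Row p clears the first column of the other rows; a kernel vector of what remains extends to
  -- one of A by solving row p for the first unknown.
  module GaussianElimination {M} (A : Fin (suc M) → Fin (suc (suc M)) → ℚ) {p} (pivot≢0 : A p zero ≢ 0ℚ) where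

    private
      instance
        pivot-nonZero : ℚ.NonZero (A p zero)
        pivot-nonZero = ℚ.≢-nonZero pivot≢0

      w : ℚ
      w = ℚ.1/ A p zero

    eliminated : Fin M → Fin (suc M) → ℚ
    eliminated r i = A (punchIn p r) (suc i) - (A (punchIn p r) zero * w) * A p (suc i)

    backSubstitute : (Fin (suc M) → ℚ) → Fin (suc (suc M)) → ℚ
    backSubstitute c = - ((c · (A p ∘ suc)) * w) ∷ c

    backSubstitute-pivotRow : ∀ c → backSubstitute c · A p ≡ 0ℚ
    backSubstitute-pivotRow c = begin
      - (S * w) * A p zero + S    ≡⟨ solve 3 (λ S w a → :- (S :* w) :* a :+ S := S :* (con 1ℚ :- w :* a)) refl S w (A p zero) ⟩
      S * (1ℚ - w * A p zero)     ≡⟨ cong (λ x → S * (1ℚ - x)) (ℚP.*-inverseˡ (A p zero)) ⟩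
      S * (1ℚ - 1ℚ)               ≡⟨ ℚP.*-zeroʳ S ⟩
      0ℚ                          ∎
      where
      open ≡-Reasoning
      open ℚSolver
      S : ℚ
      S = c · (A p ∘ suc)

    backSubstitute-otherRow : ∀ c → (∀ r → c · eliminated r ≡ 0ℚ) → ∀ r → backSubstitute c · A (punchIn p r) ≡ 0ℚ
    backSubstitute-otherRow c c·E≡0 r = begin
      - (S * w) * a + c · (A q ∘ suc)       ≡⟨ cong (_+_ (- (S * w) * a)) row-q ⟨
      - (S * w) * a + (a * w) * S           ≡⟨ solve 3 (λ S w a → :- (S :* w) :* a :+ (a :* w) :* S := con 0ℚ) refl S w a ⟩
      0ℚ                                    ∎
      where
      open ≡-Reasoning
      open ℚSolver
      q : Fin (suc M)
      q = punchIn p r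
      a S : ℚ
      a = A q zero
      S = c · (A p ∘ suc)
      row-q : (a * w) * S ≡ c · (A q ∘ suc)
      row-q = sym (x∙y⁻¹≈ε⇒x≈y _ _ (trans (sym (·-linearʳ c (A q ∘ suc) (A p ∘ suc) (a * w))) (c·E≡0 r)))

    backSubstitute-kernel : ∀ {c} → NontrivialKernelVector eliminated c → NontrivialKernelVector A (backSubstitute c)
    backSubstitute-kernel {c} (c·E≡0 , i , cᵢ≢0) = solves , suc i , cᵢ≢0
      where
      solves : ∀ r → backSubstitute c · A r ≡ 0ℚ
      solves r = case p Fin.≟ r of λ where
        (yes refl) → backSubstitute-pivotRow c
        (no p≢r)   → subst (λ q → backSubstitute c · A q ≡ 0ℚ) (FinP.punchIn-punchOut p≢r)
                           (backSubstitute-otherRow c c·E≡0 (punchOut p≢r))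

  nontrivialKernelVector : ∀ M (A : Fin M → Fin (suc M) → ℚ) → ∃ (NontrivialKernelVector A)
  nontrivialKernelVector zero    A = (λ _ → 1ℚ) , (λ ()) , zero , ℚP.1≢0
  nontrivialKernelVector (suc M) A with FinP.all? (λ r → A r zero ℚP.≟ 0ℚ)
  ... | yes column₀≡0 = basis zero , (λ r → trans (basis-· zero (A r)) (column₀≡0 r)) , zero , ℚP.1≢0
  ... | no  column₀≢0 =
    let p , pivot≢0 = FinP.¬∀⟶∃¬ _ _ (λ r → A r zero ℚP.≟ 0ℚ) column₀≢0
        open GaussianElimination A pivot≢0
    in backSubstitute _ , backSubstitute-kernel (proj₂ (nontrivialKernelVector M eliminated))

  ¬AffInd-N+2-points : ∀ {N} (ps : Vec (Vec ℚ N) (suc (suc N))) → ¬ AffInd ps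
  ¬AffInd-N+2-points {N} ps affInd =
    let c , c·A≡0 , i , cᵢ≢0 = nontrivialKernelVector (suc N) A
    in cᵢ≢0 (affInd c (trans (∑-cong (λ i → sym (ℚP.*-identityʳ (c i)))) (c·A≡0 zero)) (c·A≡0 ∘ suc) i)
    where
    A : Fin (suc N) → Fin (suc (suc N)) → ℚ
    A = (λ _ → 1ℚ) ∷ (λ j i → lookup (lookup ps i) j)

  coordinate : ∀ {N s} → Vec (Vec ℤ N) s → Fin N → Fin s → ℚ
  coordinate vs j i = toℚ (lookup (lookup vs i) j)

  -- x ∈ r·conv(vs), by weights summing to r.  Unlike InDilate this involves no division, and for a
  -- pyramid the last coordinate of a point is just the weight of the apex.
  record InScaledConv {N s} (vs : Vec (Vec ℤ N) s) (r : ℚ) (x : Vec ℚ N) : Set where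
    constructor combination
    field
      coefficient : Fin s → ℚ
      nonneg      : ∀ i → 0ℚ ≤ coefficient i
      total       : ∑ coefficient ≡ r
      coordinates : ∀ j → lookup x j ≡ coefficient · coordinate vs j

  module _ {N s} {vs : Vec (Vec ℤ N) s} where

    inScaledConv-0≤ : ∀ {r x} → InScaledConv vs r x → 0ℚ ≤ r
    inScaledConv-0≤ (combination c 0≤c refl _) = ∑-nonneg 0≤c

    inConv⇒inScaledConv : ∀ {x} → InConv vs x → InScaledConv vs 1ℚ x
    inConv⇒inScaledConv (c , 0≤c , ∑c≡1 , x≡c·) = combination c 0≤c ∑c≡1 x≡c·

    inScaledConv⇒inConv : ∀ {x} → InScaledConv vs 1ℚ x → InConv vs x
    inScaledConv⇒inConv (combination c 0≤c ∑c≡1 x≡c·) = c , 0≤c , ∑c≡1 , x≡c·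

    inScaledConv-* : ∀ {a r x} → 0ℚ ≤ a → InScaledConv vs r x → InScaledConv vs (a * r) (Vec.map (a *_) x)
    inScaledConv-* {a} {x = x} 0≤a (combination c 0≤c refl x≡c·) =
      combination (λ i → a * c i) (λ i → 0≤*-nonneg 0≤a (0≤c i)) (sym (*-distribˡ-∑ a c)) λ j → begin
        lookup (Vec.map (a *_) x) j                  ≡⟨ VecP.lookup-map j (a *_) x ⟩
        a * lookup x j                               ≡⟨ cong (a *_) (x≡c· j) ⟩
        a * (c · coordinate vs j)                    ≡⟨ *-distribˡ-∑ a (λ i → c i * coordinate vs j i) ⟩
        ∑ (λ i → a * (c i * coordinate vs j i))      ≡⟨ ∑-cong (λ i → sym (ℚP.*-assoc a (c i) _)) ⟩
        (λ i → a * c i) · coordinate vs j            ∎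
      where open ≡-Reasoning

    inDilate⇒inScaledConv : ∀ t {x} → InDilate t (InConv vs) x → InScaledConv vs (ι t) x
    inDilate⇒inScaledConv t (y , y∈P , refl) =
      subst (λ r → InScaledConv vs r (Vec.map (ι t *_) y)) (ℚP.*-identityʳ (ι t))
            (inScaledConv-* (0≤ι t) (inConv⇒inScaledConv y∈P))

    inScaledConv⇒inDilate : ∀ t {x} → InScaledConv vs (ι (suc t)) x → InDilate (suc t) (InConv vs) x
    inScaledConv⇒inDilate t {x} x∈tP =
      Vec.map (w *_) x ,
      inScaledConv⇒inConv (subst (λ r → InScaledConv vs r (Vec.map (w *_) x)) (ℚP.*-inverseˡ T)
                                 (inScaledConv-* (1/ι-suc-nonneg t) x∈tP)) ,
      sym (begin
        Vec.map (T *_) (Vec.map (w *_) x)    ≡⟨ VecP.map-∘ (T *_) (w *_) x ⟨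
        Vec.map (λ q → T * (w * q)) x        ≡⟨ VecP.map-cong T*[w*q]≡q x ⟩
        Vec.map id x                         ≡⟨ VecP.map-id x ⟩
        x                                    ∎)
      where
      open ≡-Reasoning
      T : ℚ
      T = ι (suc t)
      instance
        T-nonZero : ℚ.NonZero T
        T-nonZero = ι-suc-nonZero t
      w : ℚ
      w = ℚ.1/ T
      T*[w*q]≡q : ∀ q → T * (w * q) ≡ q
      T*[w*q]≡q q = trans (sym (ℚP.*-assoc T w q)) (trans (cong (_* q) (ℚP.*-inverseʳ T)) (ℚP.*-identityˡ q))

    lookup-map-toℚᵛ : ∀ i j → lookup (lookup (Vec.map toℚᵛ vs) i) j ≡ coordinate vs j i
    lookup-map-toℚᵛ i j = trans (cong (λ v → lookup v j) (VecP.lookup-map i toℚᵛ vs)) (VecP.lookup-map j toℚ (lookup vs i))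

    vertex∈conv : ∀ i → InConv vs (lookup (Vec.map toℚᵛ vs) i)
    vertex∈conv i = basis i , basis-nonneg i , ∑-basis i , λ j → trans (lookup-map-toℚᵛ i j) (sym (basis-· i (coordinate vs j)))

  AffIndᶻ : ∀ {N s} → Vec (Vec ℤ N) s → Set
  AffIndᶻ {N} {s} vs = (c : Fin s → ℚ) → ∑ c ≡ 0ℚ → (∀ j → c · coordinate vs j ≡ 0ℚ) → ∀ i → c i ≡ 0ℚ

  affIndᶻ⇒affInd : ∀ {N s} (vs : Vec (Vec ℤ N) s) → AffIndᶻ vs → AffInd (Vec.map toℚᵛ vs)
  affIndᶻ⇒affInd vs affInd c ∑c≡0 c·≡0 =
    affInd c ∑c≡0 λ j → trans (∑-cong (λ i → cong (c i *_) (sym (lookup-map-toℚᵛ {vs = vs} i j)))) (c·≡0 j)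

  -- Pyramids

  data Inject₁OrFromℕ : ∀ {n} → Fin (suc n) → Set where
    is-inject₁ : ∀ {n} (i : Fin n) → Inject₁OrFromℕ (inject₁ i)
    is-fromℕ   : ∀ {n} → Inject₁OrFromℕ (fromℕ n)

  inject₁OrFromℕ : ∀ {n} (i : Fin (suc n)) → Inject₁OrFromℕ i
  inject₁OrFromℕ {zero}  zero    = is-fromℕ
  inject₁OrFromℕ {suc n} zero    = is-inject₁ zero
  inject₁OrFromℕ {suc n} (suc i) with inject₁OrFromℕ i
  ... | is-inject₁ j = is-inject₁ (suc j)
  ... | is-fromℕ     = is-fromℕ

  lookup-∷ʳ-inject₁ : ∀ {A : Set} {n} (xs : Vec A n) x i → lookup (xs ∷ʳ x) (inject₁ i) ≡ lookup xs i
  lookup-∷ʳ-inject₁ (_ Vec.∷ _)  x zero    = refl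
  lookup-∷ʳ-inject₁ (_ Vec.∷ xs) x (suc i) = lookup-∷ʳ-inject₁ xs x i

  lookup-∷ʳ-fromℕ : ∀ {A : Set} {n} (xs : Vec A n) x → lookup (xs ∷ʳ x) (fromℕ n) ≡ x
  lookup-∷ʳ-fromℕ []           x = refl
  lookup-∷ʳ-fromℕ (_ Vec.∷ xs) x = lookup-∷ʳ-fromℕ xs x

  infixl 5 _∷ʳᶠ_
  _∷ʳᶠ_ : ∀ {A : Set} {n} → (Fin n → A) → A → Fin (suc n) → A
  _∷ʳᶠ_ {n = zero}  c h = λ _ → h
  _∷ʳᶠ_ {n = suc n} c h = c zero ∷ (c ∘ suc ∷ʳᶠ h)

  init-∷ʳᶠ : ∀ {A : Set} {n} (c : Fin n → A) h → init (c ∷ʳᶠ h) ≗ c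
  init-∷ʳᶠ c h zero    = refl
  init-∷ʳᶠ c h (suc i) = init-∷ʳᶠ (c ∘ suc) h i

  last-∷ʳᶠ : ∀ {A : Set} {n} (c : Fin n → A) h → last (c ∷ʳᶠ h) ≡ h
  last-∷ʳᶠ {n = zero}  c h = refl
  last-∷ʳᶠ {n = suc n} c h = last-∷ʳᶠ (c ∘ suc) h

  module _ {N s} (vs : Vec (Vec ℤ N) s) where

    lookup-pyr-inject₁ : ∀ i → lookup (pyr vs) (inject₁ i) ≡ lookup vs i ∷ʳ + 0
    lookup-pyr-inject₁ i =
      trans (lookup-∷ʳ-inject₁ (Vec.map (_∷ʳ + 0) vs) (Vec.replicate N (+ 0) ∷ʳ + 1) i) (VecP.lookup-map i (_∷ʳ + 0) vs)

    lookup-pyr-fromℕ : lookup (pyr vs) (fromℕ s) ≡ Vec.replicate N (+ 0) ∷ʳ + 1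
    lookup-pyr-fromℕ = lookup-∷ʳ-fromℕ (Vec.map (_∷ʳ + 0) vs) (Vec.replicate N (+ 0) ∷ʳ + 1)

    init-coordinate-pyr-inject₁ : ∀ j → init (coordinate (pyr vs) (inject₁ j)) ≗ coordinate vs j
    init-coordinate-pyr-inject₁ j i = cong toℚ (begin
      lookup (lookup (pyr vs) (inject₁ i)) (inject₁ j)   ≡⟨ cong (λ v → lookup v (inject₁ j)) (lookup-pyr-inject₁ i) ⟩
      lookup (lookup vs i ∷ʳ + 0) (inject₁ j)           ≡⟨ lookup-∷ʳ-inject₁ (lookup vs i) (+ 0) j ⟩
      lookup (lookup vs i) j                            ∎)
      where open ≡-Reasoning

    last-coordinate-pyr-inject₁ : ∀ j → last (coordinate (pyr vs) (inject₁ j)) ≡ 0ℚ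
    last-coordinate-pyr-inject₁ j = cong toℚ (begin
      lookup (lookup (pyr vs) (fromℕ s)) (inject₁ j)      ≡⟨ cong (λ v → lookup v (inject₁ j)) lookup-pyr-fromℕ ⟩
      lookup (Vec.replicate N (+ 0) ∷ʳ + 1) (inject₁ j)   ≡⟨ lookup-∷ʳ-inject₁ (Vec.replicate N (+ 0)) (+ 1) j ⟩
      lookup (Vec.replicate N (+ 0)) j                    ≡⟨ VecP.lookup-replicate j (+ 0) ⟩
      + 0                                                 ∎)
      where open ≡-Reasoning

    init-coordinate-pyr-fromℕ : init (coordinate (pyr vs) (fromℕ N)) ≗ λ _ → 0ℚ
    init-coordinate-pyr-fromℕ i =
      cong toℚ (trans (cong (λ v → lookup v (fromℕ N)) (lookup-pyr-inject₁ i)) (lookup-∷ʳ-fromℕ (lookup vs i) (+ 0)))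

    last-coordinate-pyr-fromℕ : last (coordinate (pyr vs) (fromℕ N)) ≡ 1ℚ
    last-coordinate-pyr-fromℕ =
      cong toℚ (trans (cong (λ v → lookup v (fromℕ N)) lookup-pyr-fromℕ) (lookup-∷ʳ-fromℕ (Vec.replicate N (+ 0)) (+ 1)))

    ·-coordinate-pyr-inject₁ : ∀ c j → c · coordinate (pyr vs) (inject₁ j) ≡ init c · coordinate vs j
    ·-coordinate-pyr-inject₁ c j = begin
      c · coordinate (pyr vs) (inject₁ j)                  ≡⟨ ·-init-last c (coordinate (pyr vs) (inject₁ j)) ⟩
      init c · init (coordinate (pyr vs) (inject₁ j))
        + last c * last (coordinate (pyr vs) (inject₁ j))  ≡⟨ cong₂ _+_ (∑-cong (λ i → cong (init c i *_) (init-coordinate-pyr-inject₁ j i)))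
                                                                        (cong (last c *_) (last-coordinate-pyr-inject₁ j)) ⟩
      init c · coordinate vs j + last c * 0ℚ               ≡⟨ cong (_+_ (init c · coordinate vs j)) (ℚP.*-zeroʳ (last c)) ⟩
      init c · coordinate vs j + 0ℚ                        ≡⟨ ℚP.+-identityʳ (init c · coordinate vs j) ⟩
      init c · coordinate vs j                             ∎
      where open ≡-Reasoning

    ·-coordinate-pyr-fromℕ : ∀ c → c · coordinate (pyr vs) (fromℕ N) ≡ last c
    ·-coordinate-pyr-fromℕ c = begin
      c · coordinate (pyr vs) (fromℕ N)                    ≡⟨ ·-init-last c (coordinate (pyr vs) (fromℕ N)) ⟩
      init c · init (coordinate (pyr vs) (fromℕ N))
        + last c * last (coordinate (pyr vs) (fromℕ N))    ≡⟨ cong₂ _+_ (∑-cong (λ i → cong (init c i *_) (init-coordinate-pyr-fromℕ i)))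
                                                                        (cong (last c *_) last-coordinate-pyr-fromℕ) ⟩
      init c · (λ _ → 0ℚ) + last c * 1ℚ                    ≡⟨ cong₂ _+_ (trans (∑-cong (ℚP.*-zeroʳ ∘ init c)) (∑-zero s)) (ℚP.*-identityʳ (last c)) ⟩
      0ℚ + last c                                          ≡⟨ ℚP.+-identityˡ (last c) ⟩
      last c                                               ∎
      where open ≡-Reasoning

    inScaledConv-pyr⁻ : ∀ {r x h} → InScaledConv (pyr vs) r (x ∷ʳ h) → 0ℚ ≤ h × InScaledConv vs (r - h) x
    inScaledConv-pyr⁻ {r} {x} {h} (combination c 0≤c ∑c≡r x∷ʳh≡c·) =
      subst (0ℚ ≤_) (sym h≡last) (0≤c (fromℕ s)) , combination (init c) (0≤c ∘ inject₁) ∑init≡r-h x≡init·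
      where
      h≡last : h ≡ last c
      h≡last = trans (sym (lookup-∷ʳ-fromℕ x h)) (trans (x∷ʳh≡c· (fromℕ N)) (·-coordinate-pyr-fromℕ c))
      ∑init≡r-h : ∑ (init c) ≡ r - h
      ∑init≡r-h = begin
        ∑ (init c)                      ≡⟨ solve 2 (λ a b → a := (a :+ b) :- b) refl (∑ (init c)) (last c) ⟩
        (∑ (init c) + last c) - last c  ≡⟨ cong₂ _-_ (trans (sym (∑-init-last c)) ∑c≡r) (sym h≡last) ⟩
        r - h                           ∎
        where
        open ≡-Reasoning
        open ℚSolver
      x≡init· : ∀ j → lookup x j ≡ init c · coordinate vs j
      x≡init· j = trans (sym (lookup-∷ʳ-inject₁ x h j)) (trans (x∷ʳh≡c· (inject₁ j)) (·-coordinate-pyr-inject₁ c j))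

    inScaledConv-pyr⁺ : ∀ {r x h} → 0ℚ ≤ h → InScaledConv vs r x → InScaledConv (pyr vs) (r + h) (x ∷ʳ h)
    inScaledConv-pyr⁺ {r} {x} {h} 0≤h (combination c 0≤c ∑c≡r x≡c·) =
      combination (c ∷ʳᶠ h) 0≤c∷ʳh ∑c∷ʳh≡r+h x∷ʳh≡c∷ʳh·
      where
      0≤c∷ʳh : ∀ i → 0ℚ ≤ (c ∷ʳᶠ h) i
      0≤c∷ʳh i with inject₁OrFromℕ i
      ... | is-inject₁ i = subst (0ℚ ≤_) (sym (init-∷ʳᶠ c h i)) (0≤c i)
      ... | is-fromℕ     = subst (0ℚ ≤_) (sym (last-∷ʳᶠ c h)) 0≤h
      ∑c∷ʳh≡r+h : ∑ (c ∷ʳᶠ h) ≡ r + h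
      ∑c∷ʳh≡r+h = trans (∑-init-last (c ∷ʳᶠ h)) (cong₂ _+_ (trans (∑-cong (init-∷ʳᶠ c h)) ∑c≡r) (last-∷ʳᶠ c h))
      x∷ʳh≡c∷ʳh· : ∀ j → lookup (x ∷ʳ h) j ≡ (c ∷ʳᶠ h) · coordinate (pyr vs) j
      x∷ʳh≡c∷ʳh· j with inject₁OrFromℕ j
      ... | is-inject₁ j = begin
        lookup (x ∷ʳ h) (inject₁ j)                    ≡⟨ lookup-∷ʳ-inject₁ x h j ⟩
        lookup x j                                     ≡⟨ x≡c· j ⟩
        c · coordinate vs j                            ≡⟨ ∑-cong (λ i → cong (_* coordinate vs j i) (init-∷ʳᶠ c h i)) ⟨
        init (c ∷ʳᶠ h) · coordinate vs j               ≡⟨ ·-coordinate-pyr-inject₁ (c ∷ʳᶠ h) j ⟨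
        (c ∷ʳᶠ h) · coordinate (pyr vs) (inject₁ j)    ∎
        where open ≡-Reasoning
      ... | is-fromℕ = trans (lookup-∷ʳ-fromℕ x h) (sym (trans (·-coordinate-pyr-fromℕ (c ∷ʳᶠ h)) (last-∷ʳᶠ c h)))

    affIndᶻ-pyr : AffIndᶻ vs → AffIndᶻ (pyr vs)
    affIndᶻ-pyr affInd c ∑c≡0 c·≡0 = c≡0
      where
      last≡0 : last c ≡ 0ℚ
      last≡0 = trans (sym (·-coordinate-pyr-fromℕ c)) (c·≡0 (fromℕ N))
      ∑init≡0 : ∑ (init c) ≡ 0ℚ
      ∑init≡0 = begin
        ∑ (init c)            ≡⟨ ℚP.+-identityʳ (∑ (init c)) ⟨
        ∑ (init c) + 0ℚ       ≡⟨ cong (_+_ (∑ (init c))) last≡0 ⟨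
        ∑ (init c) + last c   ≡⟨ ∑-init-last c ⟨
        ∑ c                   ≡⟨ ∑c≡0 ⟩
        0ℚ                    ∎
        where open ≡-Reasoning
      c≡0 : ∀ i → c i ≡ 0ℚ
      c≡0 i with inject₁OrFromℕ i
      ... | is-inject₁ i = affInd (init c) ∑init≡0 (λ j → trans (sym (·-coordinate-pyr-inject₁ c j)) (c·≡0 (inject₁ j))) i
      ... | is-fromℕ     = last≡0

  -- The Reeve tetrahedron

  module _ (m : ℕ) (c : Fin 4 → ℚ) where
    open ℚSolver

    private
      O I : ∀ {n} → Polynomial n
      O = con 0ℚ
      I = con 1ℚ

    ·-coordinate-reeve-x : c · coordinate (reeve m) 0F ≡ c 1F + c 3F
    ·-coordinate-reeve-x =
      solve 4 (λ c₀ c₁ c₂ c₃ → c₀ :* O :+ (c₁ :* I :+ (c₂ :* O :+ (c₃ :* I :+ O))) := c₁ :+ c₃) refl (c 0F) (c 1F) (c 2F) (c 3F)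

    ·-coordinate-reeve-y : c · coordinate (reeve m) 1F ≡ c 2F + c 3F
    ·-coordinate-reeve-y =
      solve 4 (λ c₀ c₁ c₂ c₃ → c₀ :* O :+ (c₁ :* O :+ (c₂ :* I :+ (c₃ :* I :+ O))) := c₂ :+ c₃) refl (c 0F) (c 1F) (c 2F) (c 3F)

    ·-coordinate-reeve-z : c · coordinate (reeve m) 2F ≡ c 3F * ι m
    ·-coordinate-reeve-z =
      solve 5 (λ c₀ c₁ c₂ c₃ M → c₀ :* O :+ (c₁ :* O :+ (c₂ :* O :+ (c₃ :* M :+ O))) := c₃ :* M) refl (c 0F) (c 1F) (c 2F) (c 3F) (ι m)

  -- The facet inequalities of r·T_m, for M = m.
  ReeveIneq : ℚ → ℚ → ℚ → ℚ → ℚ → Set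
  ReeveIneq M r x y z = 0ℚ ≤ z × z ≤ M * x × z ≤ M * y × M * x + M * y ≤ M * r + z

  reeveIneq-cong : ∀ {M r x y z x′ y′ z′} → x ≡ x′ → y ≡ y′ → z ≡ z′ → ReeveIneq M r x y z → ReeveIneq M r x′ y′ z′
  reeveIneq-cong refl refl refl ineq = ineq

  -- The slack in each facet inequality is M times one of the weights.
  reeveIneq-combination : ∀ m (c : Fin 4 → ℚ) → (∀ i → 0ℚ ≤ c i) →
                          ReeveIneq (ι m) (∑ c) (c 1F + c 3F) (c 2F + c 3F) (c 3F * ι m)
  reeveIneq-combination m c 0≤c =
    0≤*-nonneg (0≤c 3F) (0≤ι m) , ≡+nonneg⇒≤ (M * c₁) (0≤Mc 1F) x-slack , ≡+nonneg⇒≤ (M * c₂) (0≤Mc 2F) y-slack ,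
    ≡+nonneg⇒≤ (M * c₀) (0≤Mc 0F) top-slack
    where
    open ℚSolver
    M c₀ c₁ c₂ c₃ : ℚ
    M = ι m
    c₀ = c 0F
    c₁ = c 1F
    c₂ = c 2F
    c₃ = c 3F
    0≤Mc : ∀ i → 0ℚ ≤ M * c i
    0≤Mc i = 0≤*-nonneg (0≤ι m) (0≤c i)
    x-slack : M * (c₁ + c₃) ≡ c₃ * M + M * c₁
    x-slack = solve 3 (λ M c₁ c₃ → M :* (c₁ :+ c₃) := c₃ :* M :+ M :* c₁) refl M c₁ c₃
    y-slack : M * (c₂ + c₃) ≡ c₃ * M + M * c₂
    y-slack = solve 3 (λ M c₂ c₃ → M :* (c₂ :+ c₃) := c₃ :* M :+ M :* c₂) refl M c₂ c₃
    top-slack : M * ∑ c + c₃ * M ≡ (M * (c₁ + c₃) + M * (c₂ + c₃)) + M * c₀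
    top-slack = solve 5 (λ M c₀ c₁ c₂ c₃ → M :* (c₀ :+ (c₁ :+ (c₂ :+ (c₃ :+ con 0ℚ)))) :+ c₃ :* M
                                         := (M :* (c₁ :+ c₃) :+ M :* (c₂ :+ c₃)) :+ M :* c₀) refl M c₀ c₁ c₂ c₃

  inScaledConv-reeve⁻ : ∀ {m r x y z} → InScaledConv (reeve m) r (x Vec.∷ y Vec.∷ z Vec.∷ []) → ReeveIneq (ι m) r x y z
  inScaledConv-reeve⁻ {m} (combination c 0≤c refl x≡c·) =
    reeveIneq-cong {ι m} {∑ c} (sym (trans (x≡c· 0F) (·-coordinate-reeve-x m c)))
                               (sym (trans (x≡c· 1F) (·-coordinate-reeve-y m c)))
                               (sym (trans (x≡c· 2F) (·-coordinate-reeve-z m c)))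
                               (reeveIneq-combination m c 0≤c)

  module _ {m : ℕ} where

    private
      M W : ℚ
      M = ι (suc m)
      W = (ℚ.1/ M) {{ι-suc-nonZero m}}

      W*[M*a]≡a : ∀ a → W * (M * a) ≡ a
      W*[M*a]≡a a =
        trans (sym (ℚP.*-assoc W M a)) (trans (cong (_* a) (ℚP.*-inverseˡ M {{ι-suc-nonZero m}})) (ℚP.*-identityˡ a))

    inScaledConv-reeve⁺ : ∀ {r x y z} → ReeveIneq M r x y z → InScaledConv (reeve (suc m)) r (x Vec.∷ y Vec.∷ z Vec.∷ [])
    inScaledConv-reeve⁺ {r} {x} {y} {z} (0≤z , z≤Mx , z≤My , Mx+My≤Mr+z) = combination c 0≤c ∑c≡r x≡c·
      where
      open ℚSolver
      -- The weights are the slacks in the facet inequalities, divided by M.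
      c : Fin 4 → ℚ
      c 0F = W * ((M * r + z) - (M * x + M * y))
      c 1F = W * (M * x - z)
      c 2F = W * (M * y - z)
      c 3F = W * z
      0≤c : ∀ i → 0ℚ ≤ c i
      0≤c 0F = 0≤*-nonneg (1/ι-suc-nonneg m) (p≤q⇒0≤q-p Mx+My≤Mr+z)
      0≤c 1F = 0≤*-nonneg (1/ι-suc-nonneg m) (p≤q⇒0≤q-p z≤Mx)
      0≤c 2F = 0≤*-nonneg (1/ι-suc-nonneg m) (p≤q⇒0≤q-p z≤My)
      0≤c 3F = 0≤*-nonneg (1/ι-suc-nonneg m) 0≤z
      ∑c≡r : ∑ c ≡ r
      ∑c≡r = trans (solve 6 (λ W M r x y z → W :* ((M :* r :+ z) :- (M :* x :+ M :* y))
                                               :+ (W :* (M :* x :- z) :+ (W :* (M :* y :- z) :+ (W :* z :+ con 0ℚ)))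
                                             := W :* (M :* r)) refl W M r x y z)
                   (W*[M*a]≡a r)
      x≡c· : ∀ j → lookup (x Vec.∷ y Vec.∷ z Vec.∷ []) j ≡ c · coordinate (reeve (suc m)) j
      x≡c· 0F = sym (trans (·-coordinate-reeve-x (suc m) c)
                  (trans (solve 4 (λ W M x z → W :* (M :* x :- z) :+ W :* z := W :* (M :* x)) refl W M x z) (W*[M*a]≡a x)))
      x≡c· 1F = sym (trans (·-coordinate-reeve-y (suc m) c)
                  (trans (solve 4 (λ W M y z → W :* (M :* y :- z) :+ W :* z := W :* (M :* y)) refl W M y z) (W*[M*a]≡a y)))
      x≡c· 2F = sym (trans (·-coordinate-reeve-z (suc m) c)
                  (trans (solve 3 (λ W M z → W :* z :* M := W :* (M :* z)) refl W M z) (W*[M*a]≡a z)))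

    affIndᶻ-reeve : AffIndᶻ (reeve (suc m))
    affIndᶻ-reeve c ∑c≡0 c·≡0 = c≡0
      where
      open ℚSolver
      c₃≡0 : c 3F ≡ 0ℚ
      c₃≡0 = begin
        c 3F             ≡⟨ W*[M*a]≡a (c 3F) ⟨
        W * (M * c 3F)   ≡⟨ cong (W *_) (trans (ℚP.*-comm M (c 3F)) (trans (sym (·-coordinate-reeve-z (suc m) c)) (c·≡0 2F))) ⟩
        W * 0ℚ           ≡⟨ ℚP.*-zeroʳ W ⟩
        0ℚ               ∎
        where open ≡-Reasoning
      cancel-c₃ : ∀ {a} → a + c 3F ≡ 0ℚ → a ≡ 0ℚ
      cancel-c₃ {a} a+c₃≡0 = trans (solve 2 (λ a b → a := (a :+ b) :- b) refl a (c 3F)) (cong₂ _-_ a+c₃≡0 c₃≡0)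
      c≡0 : ∀ i → c i ≡ 0ℚ
      c≡0 0F = trans (solve 4 (λ c₀ c₁ c₂ c₃ → c₀ := (c₀ :+ (c₁ :+ (c₂ :+ (c₃ :+ con 0ℚ)))) :- c₁ :- c₂ :- c₃)
                              refl (c 0F) (c 1F) (c 2F) (c 3F))
                     (cong₂ _-_ (cong₂ _-_ (cong₂ _-_ ∑c≡0 (c≡0 1F)) (c≡0 2F)) c₃≡0)
      c≡0 1F = cancel-c₃ (trans (sym (·-coordinate-reeve-x (suc m) c)) (c·≡0 0F))
      c≡0 2F = cancel-c₃ (trans (sym (·-coordinate-reeve-y (suc m) c)) (c·≡0 1F))
      c≡0 3F = c₃≡0

  LatticePoint : ∀ {N s} → Vec (Vec ℤ N) s → ℕ → Vec ℤ N → Set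
  LatticePoint vs t x = InScaledConv vs (ι t) (toℚᵛ x)

  module _ {N s} {vs : Vec (Vec ℤ N) s} where

    latticePoint-pyr⁻ : ∀ t {x h} → LatticePoint (pyr vs) t (x ∷ʳ h) →
                        ∃₂ λ u H → u ℕ.+ H ≡ t × h ≡ + H × LatticePoint vs u x
    latticePoint-pyr⁻ t {x} {h} x∷ʳh∈tP = apexHeight (toℚ-nonneg⇒ℕ h (proj₁ pyr⁻)) (proj₂ pyr⁻)
      where
      pyr⁻ : 0ℚ ≤ toℚ h × InScaledConv vs (ι t - toℚ h) (toℚᵛ x)
      pyr⁻ = inScaledConv-pyr⁻ vs (subst (InScaledConv (pyr vs) (ι t)) (VecP.map-∷ʳ toℚ h x) x∷ʳh∈tP)
      apexHeight : (∃ λ H → h ≡ + H) → InScaledConv vs (ι t - toℚ h) (toℚᵛ x) →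
                   ∃₂ λ u H → u ℕ.+ H ≡ t × h ≡ + H × LatticePoint vs u x
      apexHeight (H , refl) x∈[t-H]P =
        t ℕ.∸ H , H , ℕP.m∸n+n≡m H≤t , refl , subst (λ r → InScaledConv vs r (toℚᵛ x)) t-H≡t∸H x∈[t-H]P
        where
        H≤t : H ℕ.≤ t
        H≤t = ι-cancel-≤ (0≤q-p⇒p≤q (inScaledConv-0≤ x∈[t-H]P))
        t-H≡t∸H : ι t - ι H ≡ ι (t ℕ.∸ H)
        t-H≡t∸H = begin
          ι t - ι H                  ≡⟨ cong (λ n → ι n - ι H) (ℕP.m∸n+n≡m H≤t) ⟨
          ι (t ℕ.∸ H ℕ.+ H) - ι H    ≡⟨ cong (_- ι H) (ι-+ (t ℕ.∸ H) H) ⟩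
          (ι (t ℕ.∸ H) + ι H) - ι H  ≡⟨ solve 2 (λ a b → (a :+ b) :- b := a) refl (ι (t ℕ.∸ H)) (ι H) ⟩
          ι (t ℕ.∸ H)                ∎
          where
          open ≡-Reasoning
          open ℚSolver

    latticePoint-pyr⁺ : ∀ u H {x} → LatticePoint vs u x → LatticePoint (pyr vs) (u ℕ.+ H) (x ∷ʳ + H)
    latticePoint-pyr⁺ u H {x} x∈uP =
      subst₂ (InScaledConv (pyr vs)) (sym (ι-+ u H)) (sym (VecP.map-∷ʳ toℚ (+ H) x)) (inScaledConv-pyr⁺ vs (0≤ι H) x∈uP)

  point : ℕ → ℕ → ℕ → Vec ℤ 3
  point x y z = + x Vec.∷ + y Vec.∷ + z Vec.∷ []

  ReeveIneqℕ : ℕ → ℕ → ℕ → ℕ → ℕ → Set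
  ReeveIneqℕ m t x y z = z ℕ.≤ m ℕ.* x × z ℕ.≤ m ℕ.* y × m ℕ.* x ℕ.+ m ℕ.* y ℕ.≤ m ℕ.* t ℕ.+ z

  ReevePoint : ℕ → ℕ → Vec ℤ 3 → Set
  ReevePoint m t v = ∃₂ λ x y → ∃ λ z → v ≡ point x y z × ReeveIneqℕ m t x y z

  module _ (m t x y z : ℕ) where

    private
      ι-sides : ι (m ℕ.* x ℕ.+ m ℕ.* y) ≡ ι m * ι x + ι m * ι y
      ι-sides = trans (ι-+ (m ℕ.* x) (m ℕ.* y)) (cong₂ _+_ (ι-* m x) (ι-* m y))

      ι-top : ι (m ℕ.* t ℕ.+ z) ≡ ι m * ι t + ι z
      ι-top = trans (ι-+ (m ℕ.* t) z) (cong (_+ ι z) (ι-* m t))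

    reeveIneq⇒ℕ : ReeveIneq (ι m) (ι t) (ι x) (ι y) (ι z) → ReeveIneqℕ m t x y z
    reeveIneq⇒ℕ (_ , z≤mx , z≤my , sides≤top) =
      ι-cancel-≤ (subst (ι z ≤_) (sym (ι-* m x)) z≤mx) ,
      ι-cancel-≤ (subst (ι z ≤_) (sym (ι-* m y)) z≤my) ,
      ι-cancel-≤ (subst₂ _≤_ (sym ι-sides) (sym ι-top) sides≤top)

    ℕ⇒reeveIneq : ReeveIneqℕ m t x y z → ReeveIneq (ι m) (ι t) (ι x) (ι y) (ι z)
    ℕ⇒reeveIneq (z≤mx , z≤my , sides≤top) =
      0≤ι z ,
      subst (ι z ≤_) (ι-* m x) (ι-mono-≤ z≤mx) ,
      subst (ι z ≤_) (ι-* m y) (ι-mono-≤ z≤my) ,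
      subst₂ _≤_ ι-sides ι-top (ι-mono-≤ sides≤top)

  module _ {m : ℕ} where

    latticePoint-reeve⁻ : ∀ t {v} → LatticePoint (reeve (suc m)) t v → ReevePoint (suc m) t v
    latticePoint-reeve⁻ t {a Vec.∷ b Vec.∷ c Vec.∷ []} v∈tT =
      naturals (toℚ-nonneg⇒ℕ a 0≤a) (toℚ-nonneg⇒ℕ b 0≤b) (toℚ-nonneg⇒ℕ c 0≤c) ineq
      where
      ineq : ReeveIneq (ι (suc m)) (ι t) (toℚ a) (toℚ b) (toℚ c)
      ineq = inScaledConv-reeve⁻ v∈tT
      0≤a : 0ℚ ≤ toℚ a
      0≤b : 0ℚ ≤ toℚ b
      0≤c : 0ℚ ≤ toℚ c
      0≤c = proj₁ ineq
      0≤a = 0≤≤*⇒0≤ (ι (suc m)) (ι-suc-positive m) 0≤c (proj₁ (proj₂ ineq))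
      0≤b = 0≤≤*⇒0≤ (ι (suc m)) (ι-suc-positive m) 0≤c (proj₁ (proj₂ (proj₂ ineq)))
      naturals : (∃ λ x → a ≡ + x) → (∃ λ y → b ≡ + y) → (∃ λ z → c ≡ + z) →
                 ReeveIneq (ι (suc m)) (ι t) (toℚ a) (toℚ b) (toℚ c) → ReevePoint (suc m) t (a Vec.∷ b Vec.∷ c Vec.∷ [])
      naturals (x , refl) (y , refl) (z , refl) ineqℕ = x , y , z , refl , reeveIneq⇒ℕ (suc m) t x y z ineqℕ

    latticePoint-reeve⁺ : ∀ t {v} → ReevePoint (suc m) t v → LatticePoint (reeve (suc m)) t v
    latticePoint-reeve⁺ t (x , y , z , refl , ineq) = inScaledConv-reeve⁺ (ℕ⇒reeveIneq (suc m) t x y z ineq)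

open Geometry

open import Data.Nat using (_+_; _*_; _∸_; _≤_; _<_)
open import Data.Nat.Combinatorics using (_C_; nCk+nC[k+1]≡[n+1]C[k+1]; k>n⇒nCk≡0)
open import Data.Nat.DivMod using (_%_; _/_; [m+kn]%n≡m%n; m<n⇒m%n≡m; m%n<n; m≡m%n+[m/n]*n)
open import Data.Nat.Tactic.RingSolver using (solve-∀)

-- Enumerating lattice points

record Enumerates {A : Set} (P : A → Set) (xs : List A) : Set where
  field
    unique   : Unique xs
    sound    : ∀ {x} → x ∈ xs → P x
    complete : ∀ {x} → P x → x ∈ xs

enumerates-resp : ∀ {A : Set} {P Q : A → Set} {xs} → (∀ {x} → P x → Q x) → (∀ {x} → Q x → P x) →
                  Enumerates P xs → Enumerates Q xs
enumerates-resp P⇒Q Q⇒P e = record { unique = unique ; sound = P⇒Q ∘ sound ; complete = complete ∘ Q⇒P }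
  where open Enumerates e

∑< : ℕ → (ℕ → ℕ) → ℕ
∑< zero    f = 0
∑< (suc n) f = f n + ∑< n f

∑<-cong : ∀ n {f g : ℕ → ℕ} → (∀ u → f u ≡ g u) → ∑< n f ≡ ∑< n g
∑<-cong zero    f≗g = refl
∑<-cong (suc n) f≗g = cong₂ _+_ (f≗g n) (∑<-cong n f≗g)

∑<-distrib-+ : ∀ n (f g : ℕ → ℕ) → ∑< n (λ u → f u + g u) ≡ ∑< n f + ∑< n g
∑<-distrib-+ zero    f g = refl
∑<-distrib-+ (suc n) f g = trans (cong (_+_ (f n + g n)) (∑<-distrib-+ n f g)) (interchange (f n) (g n) (∑< n f) (∑< n g))
  where
  interchange : ∀ a b c d → a + b + (c + d) ≡ a + c + (b + d)
  interchange = solve-∀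

*-distribˡ-∑< : ∀ n a (f : ℕ → ℕ) → a * ∑< n f ≡ ∑< n (λ u → a * f u)
*-distribˡ-∑< zero    a f = ℕP.*-zeroʳ a
*-distribˡ-∑< (suc n) a f = trans (ℕP.*-distribˡ-+ a (f n) (∑< n f)) (cong (_+_ (a * f n)) (*-distribˡ-∑< n a f))

∑<-const : ∀ n c → ∑< n (λ _ → c) ≡ n * c
∑<-const zero    c = refl
∑<-const (suc n) c = cong (_+_ c) (∑<-const n c)

hockey-stick : ∀ {s q} → s ≤ q → ∀ n → ∑< n (λ u → (u + s) C q) ≡ (n + s) C suc q
hockey-stick {s} {q} s≤q n = begin
  ∑< n (λ u → (u + s) C q)                ≡⟨ ℕP.+-identityʳ _ ⟨
  ∑< n (λ u → (u + s) C q) + 0            ≡⟨ cong (_+_ (∑< n (λ u → (u + s) C q))) (k>n⇒nCk≡0 (s≤s s≤q)) ⟨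
  ∑< n (λ u → (u + s) C q) + s C suc q    ≡⟨ telescope n ⟩
  (n + s) C suc q                         ∎
  where
  open ≡-Reasoning
  telescope : ∀ n → ∑< n (λ u → (u + s) C q) + s C suc q ≡ (n + s) C suc q
  telescope zero    = refl
  telescope (suc n) = begin
    (n + s) C q + ∑< n (λ u → (u + s) C q) + s C suc q    ≡⟨ ℕP.+-assoc ((n + s) C q) _ _ ⟩
    (n + s) C q + (∑< n (λ u → (u + s) C q) + s C suc q)  ≡⟨ cong (_+_ ((n + s) C q)) (telescope n) ⟩
    (n + s) C q + (n + s) C suc q                         ≡⟨ nCk+nC[k+1]≡[n+1]C[k+1] (n + s) q ⟩
    suc (n + s) C suc q                                   ∎

module _ {A : Set} (f : ℕ → List A) where

  ∈-concatMap-downFrom⁺ : ∀ {n u x} → u < n → x ∈ f u → x ∈ concatMap f (downFrom n)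
  ∈-concatMap-downFrom⁺ u<n x∈fu = ∈-concatMap⁺ f (Any.map (λ { refl → x∈fu }) (∈-downFrom⁺ u<n))

  ∈-concatMap-downFrom⁻ : ∀ {n x} → x ∈ concatMap f (downFrom n) → ∃ λ u → u < n × x ∈ f u
  ∈-concatMap-downFrom⁻ x∈ with find (∈-concatMap⁻ f x∈)
  ... | u , u∈ , x∈fu = u , ∈-downFrom⁻ u∈ , x∈fu

  length-concatMap-downFrom : ∀ n → length (concatMap f (downFrom n)) ≡ ∑< n (length ∘ f)
  length-concatMap-downFrom zero    = refl
  length-concatMap-downFrom (suc n) = trans (length-++ (f n)) (cong (_+_ (length (f n))) (length-concatMap-downFrom n))

  unique-concatMap-downFrom : ∀ n → (∀ u → Unique (f u)) → (∀ {u v x} → u < n → v < n → x ∈ f u → x ∈ f v → u ≡ v) →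
                              Unique (concatMap f (downFrom n))
  unique-concatMap-downFrom zero    _       _        = AllPairs.[]
  unique-concatMap-downFrom (suc n) unique-f disjoint =
    Unique.++⁺ (unique-f n) (unique-concatMap-downFrom n unique-f (λ u<n v<n → disjoint (ℕP.m<n⇒m<1+n u<n) (ℕP.m<n⇒m<1+n v<n)))
      λ (x∈fn , x∈rest) → let u , u<n , x∈fu = ∈-concatMap-downFrom⁻ x∈rest
                          in ℕP.<-irrefl (disjoint (ℕP.m<n⇒m<1+n u<n) ℕP.≤-refl x∈fu x∈fn) u<n

module _ {A B : Set} (L : ℕ → List A) (f : A → ℕ → B) where

  layer : ℕ → ℕ → List B
  layer t u = map (λ x → f x (t ∸ u)) (L u)

  layered : ℕ → List B
  layered t = concatMap (layer t) (downFrom (suc t))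

  Layered : (ℕ → A → Set) → ℕ → B → Set
  Layered P t y = ∃₂ λ u h → u + h ≡ t × ∃ λ x → P u x × y ≡ f x h

  length-layered : ∀ t → length (layered t) ≡ ∑< (suc t) (length ∘ L)
  length-layered t = trans (length-concatMap-downFrom (layer t) (suc t)) (∑<-cong (suc t) (λ u → length-map _ (L u)))

  enumerates-layered : ∀ {P} → (∀ u → Enumerates (P u) (L u)) → (∀ {x x′ h h′} → f x h ≡ f x′ h′ → x ≡ x′ × h ≡ h′) →
                       ∀ t → Enumerates (Layered P t) (layered t)
  enumerates-layered {P} L-enumerates f-injective t = record
    { unique   = unique-concatMap-downFrom (layer t) (suc t) (λ u → Unique.map⁺ (proj₁ ∘ f-injective) (unique (L-enumerates u)))
                                           same-layer
    ; sound    = sound-layered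
    ; complete = complete-layered
    }
    where
    open Enumerates
    same-layer : ∀ {u v y} → u < suc t → v < suc t → y ∈ layer t u → y ∈ layer t v → u ≡ v
    same-layer {u} {v} u<1+t v<1+t y∈u y∈v with ∈-map⁻ _ y∈u | ∈-map⁻ _ y∈v
    ... | x , _ , refl | x′ , _ , fx≡fx′ =
      ℕP.∸-cancelˡ-≡ (ℕP.≤-pred u<1+t) (ℕP.≤-pred v<1+t) (proj₂ (f-injective fx≡fx′))
    sound-layered : ∀ {y} → y ∈ layered t → Layered P t y
    sound-layered y∈ with ∈-concatMap-downFrom⁻ (layer t) y∈
    ... | u , u<1+t , y∈u with ∈-map⁻ _ y∈u
    ...   | x , x∈Lu , refl = u , t ∸ u , ℕP.m+[n∸m]≡n (ℕP.≤-pred u<1+t) , x , sound (L-enumerates u) x∈Lu , refl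
    complete-layered : ∀ {y} → Layered P t y → y ∈ layered t
    complete-layered (u , h , refl , x , Pux , refl) =
      ∈-concatMap-downFrom⁺ (layer (u + h)) (s≤s (ℕP.m≤m+n u h))
        (subst (λ h′ → f x h ∈ map (λ x → f x h′) (L u)) (sym (ℕP.m+n∸m≡n u h))
               (∈-map⁺ (λ x → f x h) (complete (L-enumerates u) Pux)))

simplex : (d : ℕ) → ℕ → List (Vec ℕ d)
simplex zero    t = List.[ Vec.[] ]
simplex (suc d) t = layered (simplex d) (λ x h → h Vec.∷ x) t

enumerates-simplex : ∀ d t → Enumerates (λ x → Vec.sum x ≤ t) (simplex d t)
enumerates-simplex zero    t = record
  { unique   = All.[] AllPairs.∷ AllPairs.[]
  ; sound    = λ { (Any.here refl) → z≤n }
  ; complete = λ { {Vec.[]} _ → Any.here refl }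
  }
enumerates-simplex (suc d) t =
  enumerates-resp layered⇒sum≤ sum≤⇒layered (enumerates-layered (simplex d) (λ x h → h Vec.∷ x) (enumerates-simplex d) ∷-injective t)
  where
  ∷-injective : ∀ {x x′ : Vec ℕ d} {h h′} → h Vec.∷ x ≡ h′ Vec.∷ x′ → x ≡ x′ × h ≡ h′
  ∷-injective refl = refl , refl
  layered⇒sum≤ : ∀ {y} → Layered (simplex d) (λ x h → h Vec.∷ x) (λ u x → Vec.sum x ≤ u) t y → Vec.sum y ≤ t
  layered⇒sum≤ (u , h , refl , x , sum≤u , refl) = subst (_≤ u + h) (ℕP.+-comm (Vec.sum x) h) (ℕP.+-monoˡ-≤ h sum≤u)
  sum≤⇒layered : ∀ {y} → Vec.sum y ≤ t → Layered (simplex d) (λ x h → h Vec.∷ x) (λ u x → Vec.sum x ≤ u) t y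
  sum≤⇒layered {h Vec.∷ x} h+sum≤t = t ∸ h , h , ℕP.m∸n+n≡m (ℕP.m+n≤o⇒m≤o h h+sum≤t) , x ,
    subst (_≤ t ∸ h) (ℕP.m+n∸m≡n h (Vec.sum x)) (ℕP.∸-monoˡ-≤ h h+sum≤t) , refl

length-simplex : ∀ d t → length (simplex d t) ≡ (t + d) C d
length-simplex zero    t = refl
length-simplex (suc d) t = begin
  length (simplex (suc d) t)           ≡⟨ length-layered (simplex d) (λ x h → h Vec.∷ x) t ⟩
  ∑< (suc t) (length ∘ simplex d)      ≡⟨ ∑<-cong (suc t) (length-simplex d) ⟩
  ∑< (suc t) (λ u → (u + d) C d)       ≡⟨ hockey-stick {d} {d} ℕP.≤-refl (suc t) ⟩
  (suc t + d) C suc d                  ≡⟨ cong (_C suc d) (sym (ℕP.+-suc t d)) ⟩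
  (t + suc d) C suc d                  ∎
  where open ≡-Reasoning


-- Lattice points of t·T_m

module ReeveLattice (m′ : ℕ) where

  private
    m : ℕ
    m = suc m′

  baseLift : Vec ℕ 3 → Vec ℤ 3
  baseLift (q Vec.∷ a Vec.∷ b Vec.∷ []) = point (q + a) (q + b) (q * m)

  shiftedLift : ℕ → Vec ℕ 3 → Vec ℤ 3
  shiftedLift r (q Vec.∷ a Vec.∷ b Vec.∷ []) = point (suc (q + a)) (suc (q + b)) (suc r + q * m)

  shiftedSimplex : ℕ → ℕ → List (Vec ℤ 3)
  shiftedSimplex s r = map (shiftedLift r) (simplex 3 s)

  -- The clause for t < 2 is needed: (t ∸ 2)·Δ₃ would contain the origin.
  nonzeroResidues : ℕ → List (Vec ℤ 3)
  nonzeroResidues (suc (suc s)) = concatMap (shiftedSimplex s) (downFrom m′)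
  nonzeroResidues _             = List.[]

  reeveLattice : ℕ → List (Vec ℤ 3)
  reeveLattice t = map baseLift (simplex 3 t) ++ nonzeroResidues t

  private
    sides-base : ∀ m q a b → m * (q + a) + m * (q + b) ≡ m * (q + (a + (b + 0))) + q * m
    sides-base = solve-∀

    sides-shifted : ∀ m q a b → m * suc (q + a) + m * suc (q + b) ≡ m * (2 + (q + (a + (b + 0)))) + q * m
    sides-shifted = solve-∀

    floor-shifted : ∀ m q a → m * suc (q + a) ≡ m + q * m + m * a
    floor-shifted = solve-∀

    top-shifted : ∀ m t q → m * t + (m + q * m) ≡ m * suc t + q * m
    top-shifted = solve-∀

    *-floor-≤ : ∀ {q w} → q * m ≤ m * w → q ≤ w
    *-floor-≤ {q} {w} qm≤mw = ℕP.*-cancelˡ-≤ m (subst (_≤ m * w) (ℕP.*-comm q m) qm≤mw)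

    *-floor-< : ∀ {r q w} → suc r + q * m ≤ m * w → q < w
    *-floor-< {r} {q} {w} floor≤mw = ℕP.*-cancelˡ-< m q w (begin-strict
      m * q           ≡⟨ ℕP.*-comm m q ⟩
      q * m           <⟨ ℕP.m<n+m (q * m) (s≤s z≤n) ⟩
      suc r + q * m   ≤⟨ floor≤mw ⟩
      m * w           ∎)
      where open ℕP.≤-Reasoning

    residue : ∀ {r} q → r < m → (r + q * m) % m ≡ r
    residue {r} q r<m = trans ([m+kn]%n≡m%n r q m) (m<n⇒m%n≡m r<m)

  baseLift-ineq : ∀ {t q a b} → q + (a + (b + 0)) ≤ t → ReeveIneqℕ m t (q + a) (q + b) (q * m)
  baseLift-ineq {t} {q} {a} {b} sum≤t = floor a , floor b , sides≤top
    where
    floor : ∀ c → q * m ≤ m * (q + c)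
    floor c = subst (q * m ≤_) (sym (trans (ℕP.*-distribˡ-+ m q c) (cong (_+ m * c) (ℕP.*-comm m q)))) (ℕP.m≤m+n (q * m) (m * c))
    sides≤top : m * (q + a) + m * (q + b) ≤ m * t + q * m
    sides≤top = subst (_≤ m * t + q * m) (sym (sides-base m q a b)) (ℕP.+-monoˡ-≤ (q * m) (ℕP.*-monoʳ-≤ m sum≤t))

  shiftedLift-ineq : ∀ {s r q a b} → r < m′ → q + (a + (b + 0)) ≤ s →
                     ReeveIneqℕ m (2 + s) (suc (q + a)) (suc (q + b)) (suc r + q * m)
  shiftedLift-ineq {s} {r} {q} {a} {b} r<m′ sum≤s = floor a , floor b , sides≤top
    where
    open ℕP.≤-Reasoning
    floor : ∀ c → suc r + q * m ≤ m * suc (q + c)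
    floor c = begin
      suc r + q * m       ≤⟨ ℕP.+-monoˡ-≤ (q * m) (ℕP.m≤n⇒m≤1+n r<m′) ⟩
      m + q * m           ≤⟨ ℕP.m≤m+n (m + q * m) (m * c) ⟩
      m + q * m + m * c   ≡⟨ floor-shifted m q c ⟨
      m * suc (q + c)     ∎
    sides≤top : m * suc (q + a) + m * suc (q + b) ≤ m * (2 + s) + (suc r + q * m)
    sides≤top = begin
      m * suc (q + a) + m * suc (q + b)        ≡⟨ sides-shifted m q a b ⟩
      m * (2 + (q + (a + (b + 0)))) + q * m    ≤⟨ ℕP.+-monoˡ-≤ (q * m) (ℕP.*-monoʳ-≤ m (s≤s (s≤s sum≤s))) ⟩
      m * (2 + s) + q * m                      ≤⟨ ℕP.+-monoʳ-≤ (m * (2 + s)) (ℕP.m≤n+m (q * m) (suc r)) ⟩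
      m * (2 + s) + (suc r + q * m)            ∎

  baseLift-complete : ∀ {t x y q} → ReeveIneqℕ m t x y (q * m) → ∃₂ λ a b → x ≡ q + a × y ≡ q + b × q + (a + (b + 0)) ≤ t
  baseLift-complete {t} {q = q} (qm≤mx , qm≤my , sides≤top)
    with ℕP.m≤n⇒∃[o]m+o≡n (*-floor-≤ {q} qm≤mx) | ℕP.m≤n⇒∃[o]m+o≡n (*-floor-≤ {q} qm≤my)
  ... | a , refl | b , refl = a , b , refl , refl ,
    ℕP.*-cancelˡ-≤ m (ℕP.+-cancelʳ-≤ (q * m) _ _ (subst (_≤ m * t + q * m) (sides-base m q a b) sides≤top))

  shiftedLift-complete : ∀ {t x y r q} → suc r < m → ReeveIneqℕ m t x y (suc r + q * m) →
                         ∃₂ λ a b → x ≡ suc (q + a) × y ≡ suc (q + b) × 2 + (q + (a + (b + 0))) ≤ t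
  shiftedLift-complete {t} {r = r} {q} 1+r<m (floor≤mx , floor≤my , sides≤top)
    with ℕP.m≤n⇒∃[o]m+o≡n (*-floor-< {r} {q} floor≤mx) | ℕP.m≤n⇒∃[o]m+o≡n (*-floor-< {r} {q} floor≤my)
  ... | a , refl | b , refl = a , b , refl , refl , ℕP.≤-pred (ℕP.*-cancelˡ-< m _ _ (ℕP.+-cancelʳ-< (q * m) _ _ (begin-strict
      m * (2 + (q + (a + (b + 0)))) + q * m    ≡⟨ sides-shifted m q a b ⟨
      m * suc (q + a) + m * suc (q + b)        ≤⟨ sides≤top ⟩
      m * t + (suc r + q * m)                  <⟨ ℕP.+-monoʳ-< (m * t) (ℕP.+-monoˡ-< (q * m) 1+r<m) ⟩
      m * t + (m + q * m)                      ≡⟨ top-shifted m t q ⟩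
      m * suc t + q * m                        ∎)))
    where open ℕP.≤-Reasoning

  private
    point-injective : ∀ {x y z x′ y′ z′} → point x y z ≡ point x′ y′ z′ → x ≡ x′ × y ≡ y′ × z ≡ z′
    point-injective refl = refl , refl , refl

    simplexPoint-injective : ∀ {q a b q′ a′ b′} → q * m ≡ q′ * m → q + a ≡ q′ + a′ → q + b ≡ q′ + b′ →
                             q Vec.∷ a Vec.∷ b Vec.∷ [] ≡ q′ Vec.∷ a′ Vec.∷ b′ Vec.∷ []
    simplexPoint-injective {q} {q′ = q′} qm≡q′m qa≡q′a′ qb≡q′b′ with ℕP.*-cancelʳ-≡ q q′ m qm≡q′m
    ... | refl = cong₂ (λ a b → q Vec.∷ a Vec.∷ b Vec.∷ [])
                       (ℕP.+-cancelˡ-≡ q _ _ qa≡q′a′) (ℕP.+-cancelˡ-≡ q _ _ qb≡q′b′)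

  baseLift-injective : ∀ {v w} → baseLift v ≡ baseLift w → v ≡ w
  baseLift-injective {_ Vec.∷ _ Vec.∷ _ Vec.∷ []} {_ Vec.∷ _ Vec.∷ _ Vec.∷ []} eq =
    let qa≡ , qb≡ , qm≡ = point-injective eq in simplexPoint-injective qm≡ qa≡ qb≡

  shiftedLift-injective : ∀ r {v w} → shiftedLift r v ≡ shiftedLift r w → v ≡ w
  shiftedLift-injective r {_ Vec.∷ _ Vec.∷ _ Vec.∷ []} {_ Vec.∷ _ Vec.∷ _ Vec.∷ []} eq =
    let qa≡ , qb≡ , qm≡ = point-injective eq
    in simplexPoint-injective (ℕP.+-cancelˡ-≡ (suc r) _ _ qm≡) (ℕP.suc-injective qa≡) (ℕP.suc-injective qb≡)

  private
    point-residue : ∀ {x y x′ y′ r r′} q q′ → r < m → r′ < m → point x y (r + q * m) ≡ point x′ y′ (r′ + q′ * m) → r ≡ r′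
    point-residue q q′ r<m r′<m eq =
      trans (sym (residue q r<m)) (trans (cong (_% m) (proj₂ (proj₂ (point-injective eq)))) (residue q′ r′<m))

  shiftedLift-residue : ∀ {r r′} v w → r < m′ → r′ < m′ → shiftedLift r v ≡ shiftedLift r′ w → r ≡ r′
  shiftedLift-residue (q Vec.∷ _ Vec.∷ _ Vec.∷ []) (q′ Vec.∷ _ Vec.∷ _ Vec.∷ []) r<m′ r′<m′ eq =
    ℕP.suc-injective (point-residue q q′ (s≤s r<m′) (s≤s r′<m′) eq)

  baseLift≢shiftedLift : ∀ {r} v w → r < m′ → baseLift v ≢ shiftedLift r w
  baseLift≢shiftedLift (q Vec.∷ _ Vec.∷ _ Vec.∷ []) (q′ Vec.∷ _ Vec.∷ _ Vec.∷ []) r<m′ eq =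
    ℕP.0≢1+n (point-residue {r = 0} q q′ (s≤s z≤n) (s≤s r<m′) eq)

  open Enumerates

  unique-nonzeroResidues : ∀ t → Unique (nonzeroResidues t)
  unique-nonzeroResidues (suc (suc s)) =
    unique-concatMap-downFrom (shiftedSimplex s) m′ (λ r → Unique.map⁺ (shiftedLift-injective r) (unique (enumerates-simplex 3 s)))
      λ {r} {r′} r<m′ r′<m′ y∈r y∈r′ →
        let v , _ , y≡ = ∈-map⁻ (shiftedLift r) {xs = simplex 3 s} y∈r
            w , _ , y≡′ = ∈-map⁻ (shiftedLift r′) {xs = simplex 3 s} y∈r′
        in shiftedLift-residue v w r<m′ r′<m′ (trans (sym y≡) y≡′)
  unique-nonzeroResidues zero       = AllPairs.[]
  unique-nonzeroResidues (suc zero) = AllPairs.[]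

  unique-reeveLattice : ∀ t → Unique (reeveLattice t)
  unique-reeveLattice t =
    Unique.++⁺ (Unique.map⁺ baseLift-injective (unique (enumerates-simplex 3 t))) (unique-nonzeroResidues t) (disjoint t)
    where
    disjoint : ∀ t {y} → ¬ (y ∈ map baseLift (simplex 3 t) × y ∈ nonzeroResidues t)
    disjoint (suc (suc s)) (y∈base , y∈rest) =
      let r , r<m′ , y∈r = ∈-concatMap-downFrom⁻ (shiftedSimplex s) {m′} y∈rest
          v , _ , y≡ = ∈-map⁻ baseLift {xs = simplex 3 (suc (suc s))} y∈base
          w , _ , y≡′ = ∈-map⁻ (shiftedLift r) {xs = simplex 3 s} y∈r
      in baseLift≢shiftedLift v w r<m′ (trans (sym y≡) y≡′)

  sound-nonzeroResidues : ∀ t {y} → y ∈ nonzeroResidues t → ReevePoint m t y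
  sound-nonzeroResidues (suc (suc s)) y∈ with ∈-concatMap-downFrom⁻ (shiftedSimplex s) {m′} y∈
  ... | r , r<m′ , y∈r with ∈-map⁻ (shiftedLift r) {xs = simplex 3 s} y∈r
  ...   | q Vec.∷ a Vec.∷ b Vec.∷ [] , v∈ , refl =
    _ , _ , _ , refl , shiftedLift-ineq {s} {r} {q} {a} {b} r<m′ (sound (enumerates-simplex 3 s) v∈)

  sound-reeveLattice : ∀ t {y} → y ∈ reeveLattice t → ReevePoint m t y
  sound-reeveLattice t y∈ with ∈-++⁻ (map baseLift (simplex 3 t)) y∈
  ... | inj₂ y∈rest = sound-nonzeroResidues t y∈rest
  ... | inj₁ y∈base with ∈-map⁻ baseLift {xs = simplex 3 t} y∈base
  ...   | q Vec.∷ a Vec.∷ b Vec.∷ [] , v∈ , refl =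
    _ , _ , _ , refl , baseLift-ineq {t} {q} {a} {b} (sound (enumerates-simplex 3 t) v∈)

  complete-residue : ∀ t {x y} r q → r < m → ReeveIneqℕ m t x y (r + q * m) → point x y (r + q * m) ∈ reeveLattice t
  complete-residue t zero q _ ineq with baseLift-complete {q = q} ineq
  ... | a , b , refl , refl , sum≤t =
    ∈-++⁺ˡ (∈-map⁺ baseLift (complete (enumerates-simplex 3 t) {q Vec.∷ a Vec.∷ b Vec.∷ []} sum≤t))
  complete-residue t (suc r) q 1+r<m ineq with shiftedLift-complete {r = r} {q} 1+r<m ineq
  ... | a , b , refl , refl , s≤s (s≤s {n = s} sum≤s) =
    ∈-++⁺ʳ (map baseLift (simplex 3 t))
      (∈-concatMap-downFrom⁺ (shiftedSimplex s) (ℕP.≤-pred 1+r<m)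
        (∈-map⁺ (shiftedLift r) (complete (enumerates-simplex 3 s) {q Vec.∷ a Vec.∷ b Vec.∷ []} sum≤s)))

  enumerates-reeveLattice : ∀ t → Enumerates (ReevePoint m t) (reeveLattice t)
  enumerates-reeveLattice t = record
    { unique   = unique-reeveLattice t
    ; sound    = sound-reeveLattice t
    ; complete = λ where
        (x , y , z , refl , ineq) →
          subst (λ z → point x y z ∈ reeveLattice t) (sym (m≡m%n+[m/n]*n z m))
            (complete-residue t (z % m) (z / m) (m%n<n z m) (subst (ReeveIneqℕ m t x y) (m≡m%n+[m/n]*n z m) ineq))
    }

  length-nonzeroResidues : ∀ t → length (nonzeroResidues t) ≡ m′ * ((t + 1) C 3)
  length-nonzeroResidues zero          = sym (ℕP.*-zeroʳ m′)
  length-nonzeroResidues (suc zero)    = sym (ℕP.*-zeroʳ m′)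
  length-nonzeroResidues (suc (suc s)) = begin
    length (concatMap (shiftedSimplex s) (downFrom m′))  ≡⟨ length-concatMap-downFrom (shiftedSimplex s) m′ ⟩
    ∑< m′ (length ∘ shiftedSimplex s)                    ≡⟨ ∑<-cong m′ (λ r → trans (length-map (shiftedLift r) (simplex 3 s)) (length-simplex 3 s)) ⟩
    ∑< m′ (λ _ → (s + 3) C 3)                            ≡⟨ ∑<-const m′ ((s + 3) C 3) ⟩
    m′ * ((s + 3) C 3)                                   ≡⟨ cong (λ n → m′ * (n C 3)) (trans (ℕP.+-suc s 2) (cong suc (ℕP.+-suc s 1))) ⟩
    m′ * ((suc (suc s) + 1) C 3)                         ∎
    where open ≡-Reasoning

  length-reeveLattice : ∀ t → length (reeveLattice t) ≡ (t + 3) C 3 + m′ * ((t + 1) C 3)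
  length-reeveLattice t = trans (length-++ (map baseLift (simplex 3 t)))
    (cong₂ _+_ (trans (length-map baseLift (simplex 3 t)) (length-simplex 3 t)) (length-nonzeroResidues t))

-- Lattice points of t·Pyr^k(T_m)

open ReeveLattice using (reeveLattice; enumerates-reeveLattice; length-reeveLattice)

enumerates-reeve : ∀ m′ t → Enumerates (LatticePoint (reeve (suc m′)) t) (reeveLattice m′ t)
enumerates-reeve m′ t = enumerates-resp (latticePoint-reeve⁺ t) (latticePoint-reeve⁻ t) (enumerates-reeveLattice m′ t)

pyrLattice : ∀ {N} → (ℕ → List (Vec ℤ N)) → ℕ → List (Vec ℤ (suc N))
pyrLattice L = layered L (λ x h → x ∷ʳ + h)

module _ {N s} {vs : Vec (Vec ℤ N) s} {L : ℕ → List (Vec ℤ N)} where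

  private
    Layer : ℕ → Vec ℤ (suc N) → Set
    Layer = Layered L (λ x h → x ∷ʳ + h) (LatticePoint vs)

    ∷ʳ-injective : ∀ {x x′ : Vec ℤ N} {h h′} → x ∷ʳ + h ≡ x′ ∷ʳ + h′ → x ≡ x′ × h ≡ h′
    ∷ʳ-injective {x} {x′} eq = let x≡x′ , h≡h′ = VecP.∷ʳ-injective x x′ eq in x≡x′ , ℤP.+-injective h≡h′

  enumerates-pyr : (∀ u → Enumerates (LatticePoint vs u) (L u)) → ∀ t → Enumerates (LatticePoint (pyr vs) t) (pyrLattice L t)
  enumerates-pyr L-enumerates t =
    enumerates-resp layer⇒latticePoint latticePoint⇒layer (enumerates-layered L (λ x h → x ∷ʳ + h) L-enumerates ∷ʳ-injective t)
    where
    layer⇒latticePoint : ∀ {y} → Layer t y → LatticePoint (pyr vs) t y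
    layer⇒latticePoint (u , h , refl , x , x∈uP , refl) = latticePoint-pyr⁺ u h x∈uP
    snoc-latticePoint⇒layer : ∀ {x h} → LatticePoint (pyr vs) t (x ∷ʳ h) → Layer t (x ∷ʳ h)
    snoc-latticePoint⇒layer {x} x∷ʳh∈tP = let u , H , u+H≡t , h≡+H , x∈uP = latticePoint-pyr⁻ t x∷ʳh∈tP
                                          in u , H , u+H≡t , x , x∈uP , cong (x ∷ʳ_) h≡+H
    latticePoint⇒layer : ∀ {y} → LatticePoint (pyr vs) t y → Layer t y
    latticePoint⇒layer {y} with Vec.initLast y
    ... | x , h , refl = snoc-latticePoint⇒layer

pyrReeveLattice : ℕ → (k : ℕ) → ℕ → List (Vec ℤ (k + 3))
pyrReeveLattice m′ zero    = reeveLattice m′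
pyrReeveLattice m′ (suc k) = pyrLattice (pyrReeveLattice m′ k)

enumerates-pyrReeveLattice : ∀ m′ k t → Enumerates (LatticePoint (pyrReeve k (suc m′)) t) (pyrReeveLattice m′ k t)
enumerates-pyrReeveLattice m′ zero    = enumerates-reeve m′
enumerates-pyrReeveLattice m′ (suc k) = enumerates-pyr (enumerates-pyrReeveLattice m′ k)

length-pyrReeveLattice : ∀ m′ k t → length (pyrReeveLattice m′ k t) ≡ (t + k + 3) C (k + 3) + m′ * ((t + k + 1) C (k + 3))
length-pyrReeveLattice m′ zero    t rewrite ℕP.+-identityʳ t = length-reeveLattice m′ t
length-pyrReeveLattice m′ (suc k) t = begin
  length (pyrReeveLattice m′ (suc k) t)
    ≡⟨ length-layered (pyrReeveLattice m′ k) (λ x h → x ∷ʳ + h) t ⟩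
  ∑< (suc t) (length ∘ pyrReeveLattice m′ k)
    ≡⟨ ∑<-cong (suc t) (length-pyrReeveLattice m′ k) ⟩
  ∑< (suc t) (λ u → binomial 3 u + m′ * binomial 1 u)
    ≡⟨ ∑<-distrib-+ (suc t) (binomial 3) (λ u → m′ * binomial 1 u) ⟩
  ∑< (suc t) (binomial 3) + ∑< (suc t) (λ u → m′ * binomial 1 u)
    ≡⟨ cong (_+_ (∑< (suc t) (binomial 3))) (*-distribˡ-∑< (suc t) m′ (binomial 1)) ⟨
  ∑< (suc t) (binomial 3) + m′ * ∑< (suc t) (binomial 1)
    ≡⟨ cong₂ _+_ (∑<-binomial 3 ℕP.≤-refl) (cong (m′ *_) (∑<-binomial 1 (s≤s z≤n))) ⟩
  (t + suc k + 3) C (suc k + 3) + m′ * ((t + suc k + 1) C (suc k + 3))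
    ∎
  where
  open ≡-Reasoning
  binomial : ℕ → ℕ → ℕ
  binomial j u = (u + k + j) C (k + 3)
  ∑<-binomial : ∀ j → j ≤ 3 → ∑< (suc t) (binomial j) ≡ (t + suc k + j) C (suc k + 3)
  ∑<-binomial j j≤3 = begin
    ∑< (suc t) (binomial j)                    ≡⟨ ∑<-cong (suc t) (λ u → cong (_C (k + 3)) (ℕP.+-assoc u k j)) ⟩
    ∑< (suc t) (λ u → (u + (k + j)) C (k + 3)) ≡⟨ hockey-stick (ℕP.+-monoʳ-≤ k j≤3) (suc t) ⟩
    (suc t + (k + j)) C suc (k + 3)            ≡⟨ cong (_C suc (k + 3)) (shift t k j) ⟩
    (t + suc k + j) C (suc k + 3)              ∎
    where
    shift : ∀ t k j → suc t + (k + j) ≡ t + suc k + j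
    shift = solve-∀

affIndᶻ-pyrReeve : ∀ m′ k → AffIndᶻ (pyrReeve k (suc m′))
affIndᶻ-pyrReeve m′ zero    = affIndᶻ-reeve
affIndᶻ-pyrReeve m′ (suc k) = affIndᶻ-pyr (pyrReeve k (suc m′)) (affIndᶻ-pyrReeve m′ k)

hasDim-simplex : ∀ {N s} (vs : Vec (Vec ℤ N) s) → s ≡ suc N → AffIndᶻ vs → HasDim (InConv vs) N
hasDim-simplex vs refl affInd = (Vec.map toℚᵛ vs , vertex∈conv {vs = vs} , affIndᶻ⇒affInd vs affInd) , λ ps _ → ¬AffInd-N+2-points ps

proposition2p6 : (m k : ℕ) → 1 ≤ m → 1 ≤ k →
    HasDim (PyrReeve k m) (k + 3) ×
    ((t : ℕ) → 1 ≤ t →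
      Σ (List (Vec ℤ (k + 3))) λ L →
        Unique L ×
        All (λ x → InDilate t (PyrReeve k m) (toℚᵛ x)) L ×
        ((x : Vec ℤ (k + 3)) → InDilate t (PyrReeve k m) (toℚᵛ x) → x ∈ L) ×
        (length L ≡ ((t + k + 3) C (k + 3)) + (m ∸ 1) * ((t + k + 1) C (k + 3))))
proposition2p6 (suc m′) k _ _ =
  hasDim-simplex (pyrReeve k (suc m′)) (ℕP.+-suc k 3) (affIndᶻ-pyrReeve m′ k) , λ where
    (suc t) _ → let open Enumerates (enumerates-pyrReeveLattice m′ k (suc t)) in
      pyrReeveLattice m′ k (suc t) , unique , All.tabulate (inScaledConv⇒inDilate t ∘ sound) ,
      (λ _ → complete ∘ inDilate⇒inScaledConv (suc t)) , length-pyrReeveLattice m′ k (suc t)
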